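{- For every integer $k\ge2$, the coefficient of $n^{k-2}$ (the leading coefficient) of the polynomial $a^{(1,1)}_{\mathrm{id}_k}(n)$ is nonnegative.
   Context: $a^{(1,1)}_{\mathrm{id}_k}(n)$ is the unique polynomial in $n$ (of degree at most $k-2$) such that $a^{(1,1)}_{\mathrm{id}_k}(n)=\langle\chi^{(n-2,1,1)},M_{\mathrm{id}_k,n}\rangle$ for all sufficiently large $n$, where $\chi^{(n-2,1,1)}$ is the irreducible character of $S_n$ for the partition $(n-2,1,1)$, $\langle f,g\rangle=\frac1{n!}\sum_{\pi\in S_n}f(\pi)\overline{g(\pi)}$, and $M_{\mathrm{id}_k,n}(\pi)$ is the average, over the conjugacy class of $\pi$ in $S_n$, of the number of increasing subsequences of length $k$ of $\pi$. Explicitly, $a^{(1,1)}_{\mathrm{id}_k}(n)=\frac1{k!}\binom{n-2}{k-2}+\frac{1}{n\,k!}\binom{n-2}{k-1}+\frac{1}{2(k-1)!}\binom{n-1}{k-2}-\frac{2^{k-1}(2kn-(2k-1))\prod_{i=2}^{k-1}(2n-2i+1)}{n\,(2k-1)!}$ (empty product $=1$). -}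

module Defs where

open import Data.Nat using (ℕ; zero; suc; _∸_; _≤_; _<_; _!)
import Data.Nat as ℕ
open import Data.Nat.Combinatorics using (_C_)
open import Data.Integer using (ℤ; +_)
import Data.Integer as ℤ
open import Data.Rational using (ℚ; _/_; _+_; _-_; _*_; 0ℚ)
open import Data.List using (List; foldr; map; applyUpTo)
open import Relation.Binary.PropositionalEquality using (_≡_)

ℕ→ℚ : ℕ → ℚ
ℕ→ℚ m = + m / 1

ℤ→ℚ : ℤ → ℚ
ℤ→ℚ z = z / 1

-- division of a rational by a natural number (convention: x / 0 = 0;
-- only ever used with positive divisors for the relevant n)
divℕ : ℚ → ℕ → ℚ
divℕ x zero    = 0ℚ
divℕ x (suc d) = x * (+ 1 / suc d)

prodTerm : ℕ → ℕ → ℤ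
prodTerm k n =
  foldr ℤ._*_ (+ 1)
    (map (λ i → (+ (2 ℕ.* n) ℤ.- + (2 ℕ.* i)) ℤ.+ + 1)
         (applyUpTo (λ j → j ℕ.+ 2) (k ∸ 2)))

a11 : ℕ → ℕ → ℚ
a11 k n =
    divℕ (ℕ→ℚ ((n ∸ 2) C (k ∸ 2))) (k !)
  + divℕ (ℕ→ℚ ((n ∸ 2) C (k ∸ 1))) (n ℕ.* k !)
  + divℕ (ℕ→ℚ ((n ∸ 1) C (k ∸ 2))) (2 ℕ.* (k ∸ 1) !)
  - divℕ (ℤ→ℚ ((+ (2 ℕ.^ (k ∸ 1)))
                ℤ.* ((+ (2 ℕ.* k ℕ.* n)) ℤ.- (+ (2 ℕ.* k ∸ 1)))
                ℤ.* prodTerm k n))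
         (n ℕ.* (2 ℕ.* k ∸ 1) !)

evalPoly : (ℕ → ℚ) → ℕ → ℕ → ℚ
evalPoly c zero    x = c 0
evalPoly c (suc d) x = evalPoly c d x + c (suc d) * ℕ→ℚ (x ℕ.^ suc d)

module Submission where

-- For n ≥ 2 every term of a11 k n is a polynomial in n of degree ≤ k - 2, except the two with
-- denominator n; these combine to R(n)/n for a polynomial R of degree k - 1 with R(0) = 0
-- (by (2k-2)! = 2^(k-1) (k-1)! · 3 · 5 ⋯ (2k-3)), so R(n)/n is a polynomial too. Computing the
-- coefficient vector explicitly, the coefficient of n^(k-2) is
--   (k (k+1) (2k-1)! - 2^(2k-1) (k!)²) / (2k ((k-1)!)² (2k-1)!),
-- which is nonnegative since 4^k (k!)² ≤ (k+1) (2k)!, i.e. 4^k ≤ (k+1) (2k choose k).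

open import Defs
open import Data.Nat using (ℕ; zero; suc; _∸_; _≤_; _<_; _!; NonZero; s≤s)
import Data.Nat as ℕ
import Data.Nat.Properties as ℕP
open import Data.Nat.Properties using (_!≢0; _!*_!≢0)
open import Data.Nat.Combinatorics using (_C_; nCk+nC[k+1]≡[n+1]C[k+1])
open import Data.Nat.Coprimality using (1-coprimeTo) renaming (sym to coprime-sym)
open import Data.Nat.Tactic.RingSolver using (solve-∀)
open import Data.Integer using (ℤ)
import Data.Integer as ℤ
import Data.Integer.Properties as ℤP
open import Data.Rational
  using (ℚ; mkℚ; _/_; _+_; _-_; _*_; -_; 0ℚ; 1ℚ; NonNegative)
  renaming (_≤_ to _≤ℚ_)
import Data.Rational.Properties as ℚP
open import Data.Rational.Solver using (module +-*-Solver)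
open +-*-Solver using (solve; _:=_; _:+_; _:-_; _:*_; :-_; con)
open import Data.List using (foldr; applyUpTo)
import Data.List as List
open import Data.Vec using (Vec; []; _∷_; _∷ʳ_; map; zipWith; tail)
open import Data.Product using (Σ; _×_; ∃; _,_)
open import Function using (_∘_)
open import Relation.Binary.PropositionalEquality
  using (_≡_; refl; sym; trans; cong; cong₂; subst; subst₂; _≗_; module ≡-Reasoning)

central-binomial-bound : ∀ j → 2 ℕ.^ j ℕ.* 2 ℕ.^ j ℕ.* (j ! ℕ.* j !) ≤ suc j ℕ.* (j ℕ.+ j) !
central-binomial-bound zero    = ℕP.≤-refl
central-binomial-bound (suc j) = begin
  2 ℕ.* p ℕ.* (2 ℕ.* p) ℕ.* (suc j ℕ.* f ℕ.* (suc j ℕ.* f))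
    ≡⟨ regroup p f j ⟩
  4 ℕ.* suc j ℕ.* suc j ℕ.* (p ℕ.* p ℕ.* (f ℕ.* f))
    ≤⟨ ℕP.*-monoʳ-≤ (4 ℕ.* suc j ℕ.* suc j) (central-binomial-bound j) ⟩
  4 ℕ.* suc j ℕ.* suc j ℕ.* (suc j ℕ.* X)
    ≤⟨ ℕP.m≤m+n _ (2 ℕ.* j ℕ.* suc j ℕ.* X) ⟩
  4 ℕ.* suc j ℕ.* suc j ℕ.* (suc j ℕ.* X) ℕ.+ 2 ℕ.* j ℕ.* suc j ℕ.* X
    ≡⟨ expand j X ⟩
  suc (suc j) ℕ.* (suc (suc (j ℕ.+ j)) ℕ.* (suc (j ℕ.+ j) ℕ.* X))
    ≡⟨ cong (λ t → suc (suc j) ℕ.* (suc t) !) (ℕP.+-suc j j) ⟨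
  suc (suc j) ℕ.* (suc j ℕ.+ suc j) !
    ∎
  where
  open ℕP.≤-Reasoning
  p = 2 ℕ.^ j
  f = j !
  X = (j ℕ.+ j) !
  regroup : ∀ p f j → 2 ℕ.* p ℕ.* (2 ℕ.* p) ℕ.* (suc j ℕ.* f ℕ.* (suc j ℕ.* f))
                    ≡ 4 ℕ.* suc j ℕ.* suc j ℕ.* (p ℕ.* p ℕ.* (f ℕ.* f))
  regroup = solve-∀
  expand : ∀ j X → 4 ℕ.* suc j ℕ.* suc j ℕ.* (suc j ℕ.* X) ℕ.+ 2 ℕ.* j ℕ.* suc j ℕ.* X
                 ≡ suc (suc j) ℕ.* (suc (suc (j ℕ.+ j)) ℕ.* (suc (j ℕ.+ j) ℕ.* X))
  expand = solve-∀

open ≡-Reasoning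

ℤ→ℚ≡mkℚ : ∀ z → ℤ→ℚ z ≡ mkℚ z 0 (coprime-sym (1-coprimeTo ℤ.∣ z ∣))
ℤ→ℚ≡mkℚ z = ℚP.↥p/↧p≡p _

ℤ→ℚ-homo-+ : ∀ a b → ℤ→ℚ (a ℤ.+ b) ≡ ℤ→ℚ a + ℤ→ℚ b
ℤ→ℚ-homo-+ a b = begin
  (a ℤ.+ b) / 1                   ≡⟨ cong₂ (λ p q → (p ℤ.+ q) / 1) (ℤP.*-identityʳ a) (ℤP.*-identityʳ b) ⟨
  (a ℤ.* ℤ.1ℤ ℤ.+ b ℤ.* ℤ.1ℤ) / 1  ≡⟨ cong₂ _+_ (ℤ→ℚ≡mkℚ a) (ℤ→ℚ≡mkℚ b) ⟨
  ℤ→ℚ a + ℤ→ℚ b                   ∎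

ℤ→ℚ-homo-* : ∀ a b → ℤ→ℚ (a ℤ.* b) ≡ ℤ→ℚ a * ℤ→ℚ b
ℤ→ℚ-homo-* a b = sym (cong₂ _*_ (ℤ→ℚ≡mkℚ a) (ℤ→ℚ≡mkℚ b))

ℤ→ℚ-homo‿- : ∀ a → ℤ→ℚ (ℤ.- a) ≡ - ℤ→ℚ a
ℤ→ℚ-homo‿- a = begin
  ℤ→ℚ (ℤ.- a)                       ≡⟨ solve 2 (λ p q → p := (p :+ q) :- q) refl (ℤ→ℚ (ℤ.- a)) (ℤ→ℚ a) ⟩
  ℤ→ℚ (ℤ.- a) + ℤ→ℚ a - ℤ→ℚ a       ≡⟨ cong (_- ℤ→ℚ a) (ℤ→ℚ-homo-+ (ℤ.- a) a) ⟨
  ℤ→ℚ (ℤ.- a ℤ.+ a) - ℤ→ℚ a         ≡⟨ cong (λ t → ℤ→ℚ t - ℤ→ℚ a) (ℤP.+-inverseˡ a) ⟩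
  0ℚ - ℤ→ℚ a                        ≡⟨ ℚP.+-identityˡ (- ℤ→ℚ a) ⟩
  - ℤ→ℚ a                           ∎

ℤ→ℚ-homo-− : ∀ a b → ℤ→ℚ (a ℤ.- b) ≡ ℤ→ℚ a + - ℤ→ℚ b
ℤ→ℚ-homo-− a b = trans (ℤ→ℚ-homo-+ a (ℤ.- b)) (cong (ℤ→ℚ a +_) (ℤ→ℚ-homo‿- b))

ℕ→ℚ-homo-+ : ∀ a b → ℕ→ℚ (a ℕ.+ b) ≡ ℕ→ℚ a + ℕ→ℚ b
ℕ→ℚ-homo-+ a b = trans (cong ℤ→ℚ (ℤP.pos-+ a b)) (ℤ→ℚ-homo-+ (ℤ.+ a) (ℤ.+ b))

ℕ→ℚ-homo-* : ∀ a b → ℕ→ℚ (a ℕ.* b) ≡ ℕ→ℚ a * ℕ→ℚ b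
ℕ→ℚ-homo-* a b = trans (cong ℤ→ℚ (ℤP.pos-* a b)) (ℤ→ℚ-homo-* (ℤ.+ a) (ℤ.+ b))

ℕ→ℚ-suc : ∀ a → ℕ→ℚ (suc a) ≡ 1ℚ + ℕ→ℚ a
ℕ→ℚ-suc = ℕ→ℚ-homo-+ 1

ℕ→ℚ-homo-∸ : ∀ a b → b ≤ a → ℕ→ℚ (a ∸ b) ≡ ℕ→ℚ a - ℕ→ℚ b
ℕ→ℚ-homo-∸ a b b≤a = begin
  ℕ→ℚ (a ∸ b)                        ≡⟨ solve 2 (λ p q → p := (p :+ q) :- q) refl (ℕ→ℚ (a ∸ b)) (ℕ→ℚ b) ⟩
  ℕ→ℚ (a ∸ b) + ℕ→ℚ b - ℕ→ℚ b        ≡⟨ cong (_- ℕ→ℚ b) (ℕ→ℚ-homo-+ (a ∸ b) b) ⟨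
  ℕ→ℚ (a ∸ b ℕ.+ b) - ℕ→ℚ b          ≡⟨ cong (λ t → ℕ→ℚ t - ℕ→ℚ b) (ℕP.m∸n+n≡m b≤a) ⟩
  ℕ→ℚ a - ℕ→ℚ b                      ∎

-- Reciprocal of a natural number, with the same junk value 1/0 = 0 as divℕ.
recip : ℕ → ℚ
recip zero    = 0ℚ
recip (suc d) = ℤ.+ 1 / suc d

divℕ≡*recip : ∀ x d → divℕ x d ≡ x * recip d
divℕ≡*recip x zero    = sym (ℚP.*-zeroʳ x)
divℕ≡*recip x (suc d) = refl

recip-inverseˡ : ∀ d .{{_ : NonZero d}} → recip d * ℕ→ℚ d ≡ 1ℚ
recip-inverseˡ (suc d) =
  trans (cong₂ _*_ (ℚP.normalize-coprime (1-coprimeTo (suc d))) (ℤ→ℚ≡mkℚ (ℤ.+ suc d)))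
        (ℚP.*-inverseˡ (mkℚ (ℤ.+ suc d) 0 (coprime-sym (1-coprimeTo (suc d)))))

recip-unique : ∀ p d .{{_ : NonZero d}} → p * ℕ→ℚ d ≡ 1ℚ → p ≡ recip d
recip-unique p d p*d≡1 = begin
  p                           ≡⟨ solve 1 (λ p → p := p :* con 1ℚ) refl p ⟩
  p * 1ℚ                      ≡⟨ cong (p *_) (recip-inverseˡ d) ⟨
  p * (recip d * ℕ→ℚ d)       ≡⟨ solve 3 (λ p r D → p :* (r :* D) := (p :* D) :* r) refl p (recip d) (ℕ→ℚ d) ⟩
  p * ℕ→ℚ d * recip d         ≡⟨ cong (_* recip d) p*d≡1 ⟩
  1ℚ * recip d                ≡⟨ ℚP.*-identityˡ (recip d) ⟩
  recip d                     ∎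

recip-homo-* : ∀ a b → recip (a ℕ.* b) ≡ recip a * recip b
recip-homo-* zero    b       = sym (ℚP.*-zeroˡ (recip b))
recip-homo-* (suc a) zero    = trans (cong recip (ℕP.*-zeroʳ a)) (sym (ℚP.*-zeroʳ (recip (suc a))))
recip-homo-* (suc a) (suc b) = sym (recip-unique _ (suc a ℕ.* suc b) (begin
  recip A * recip B * ℕ→ℚ (suc a ℕ.* suc b)          ≡⟨ cong (recip A * recip B *_) (ℕ→ℚ-homo-* A B) ⟩
  recip A * recip B * (ℕ→ℚ A * ℕ→ℚ B)                ≡⟨ solve 4 (λ p q r s → p :* q :* (r :* s) := (p :* r) :* (q :* s))
                                                              refl (recip A) (recip B) (ℕ→ℚ A) (ℕ→ℚ B) ⟩
  (recip A * ℕ→ℚ A) * (recip B * ℕ→ℚ B)              ≡⟨ cong₂ _*_ (recip-inverseˡ A) (recip-inverseˡ B) ⟩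
  1ℚ                                                  ∎))
  where
  A = suc a
  B = suc b

recip-*-cancelˡ : ∀ a b .{{_ : NonZero a}} → recip (a ℕ.* b) * ℕ→ℚ a ≡ recip b
recip-*-cancelˡ a b = begin
  recip (a ℕ.* b) * ℕ→ℚ a       ≡⟨ cong (_* ℕ→ℚ a) (recip-homo-* a b) ⟩
  recip a * recip b * ℕ→ℚ a     ≡⟨ solve 3 (λ r s A → r :* s :* A := s :* (r :* A)) refl (recip a) (recip b) (ℕ→ℚ a) ⟩
  recip b * (recip a * ℕ→ℚ a)   ≡⟨ cong (recip b *_) (recip-inverseˡ a) ⟩
  recip b * 1ℚ                  ≡⟨ ℚP.*-identityʳ (recip b) ⟩
  recip b                       ∎

recip-cancel-ℕ→ℚ : ∀ a c {d} .{{_ : NonZero a}} → a ℕ.* c ≡ d → recip a * ℕ→ℚ d ≡ ℕ→ℚ c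
recip-cancel-ℕ→ℚ a c refl = begin
  recip a * ℕ→ℚ (a ℕ.* c)     ≡⟨ cong (recip a *_) (ℕ→ℚ-homo-* a c) ⟩
  recip a * (ℕ→ℚ a * ℕ→ℚ c)   ≡⟨ ℚP.*-assoc (recip a) (ℕ→ℚ a) (ℕ→ℚ c) ⟨
  recip a * ℕ→ℚ a * ℕ→ℚ c     ≡⟨ cong (_* ℕ→ℚ c) (recip-inverseˡ a) ⟩
  1ℚ * ℕ→ℚ c                  ≡⟨ ℚP.*-identityˡ (ℕ→ℚ c) ⟩
  ℕ→ℚ c                       ∎

ℕ→ℚ-nonNeg : ∀ d → NonNegative (ℕ→ℚ d)
ℕ→ℚ-nonNeg d = ℚP.normalize-nonNeg d 1

recip-nonNeg : ∀ d → NonNegative (recip d)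
recip-nonNeg zero    = _
recip-nonNeg (suc d) = ℚP.normalize-nonNeg 1 (suc d)

*ℕ≡ℕ⇒nonNeg : ∀ x d c .{{_ : NonZero d}} → x * ℕ→ℚ d ≡ ℕ→ℚ c → 0ℚ ≤ℚ x
*ℕ≡ℕ⇒nonNeg x d c x*d≡c = subst (0ℚ ≤ℚ_) (sym x≡c/d)
  (ℚP.nonNegative⁻¹ _ {{ℚP.nonNeg*nonNeg⇒nonNeg (ℕ→ℚ c) {{ℕ→ℚ-nonNeg c}} (recip d) {{recip-nonNeg d}}}})
  where
  x≡c/d : x ≡ ℕ→ℚ c * recip d
  x≡c/d = begin
    x                             ≡⟨ ℚP.*-identityʳ x ⟨
    x * 1ℚ                        ≡⟨ cong (x *_) (recip-inverseˡ d) ⟨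
    x * (recip d * ℕ→ℚ d)         ≡⟨ solve 3 (λ x r D → x :* (r :* D) := x :* D :* r) refl x (recip d) (ℕ→ℚ d) ⟩
    x * ℕ→ℚ d * recip d           ≡⟨ cong (_* recip d) x*d≡c ⟩
    ℕ→ℚ c * recip d               ∎

prod : (ℕ → ℚ) → ℕ → ℚ
prod h zero    = 1ℚ
prod h (suc j) = prod h j * h j

prod-suc : ∀ h j → prod h (suc j) ≡ h 0 * prod (h ∘ suc) j
prod-suc h zero    = trans (ℚP.*-identityˡ (h 0)) (sym (ℚP.*-identityʳ (h 0)))
prod-suc h (suc j) = begin
  prod h (suc j) * h (suc j)                   ≡⟨ cong (_* h (suc j)) (prod-suc h j) ⟩
  h 0 * prod (h ∘ suc) j * h (suc j)           ≡⟨ ℚP.*-assoc (h 0) _ (h (suc j)) ⟩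
  h 0 * prod (h ∘ suc) (suc j)                 ∎

prod-cong : ∀ {h g} → h ≗ g → ∀ j → prod h j ≡ prod g j
prod-cong h≗g zero    = refl
prod-cong h≗g (suc j) = cong₂ _*_ (prod-cong h≗g j) (h≗g j)

prod-ℕ→ℚ-const : ∀ a j → prod (λ _ → ℕ→ℚ a) j ≡ ℕ→ℚ (a ℕ.^ j)
prod-ℕ→ℚ-const a zero    = refl
prod-ℕ→ℚ-const a (suc j) = begin
  prod (λ _ → ℕ→ℚ a) j * ℕ→ℚ a    ≡⟨ cong (_* ℕ→ℚ a) (prod-ℕ→ℚ-const a j) ⟩
  ℕ→ℚ (a ℕ.^ j) * ℕ→ℚ a           ≡⟨ ℚP.*-comm (ℕ→ℚ (a ℕ.^ j)) (ℕ→ℚ a) ⟩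
  ℕ→ℚ a * ℕ→ℚ (a ℕ.^ j)           ≡⟨ ℕ→ℚ-homo-* a (a ℕ.^ j) ⟨
  ℕ→ℚ (a ℕ.^ suc j)               ∎

prod-recip-suc : ∀ j → prod (λ i → recip (suc i)) j ≡ recip (j !)
prod-recip-suc zero    = refl
prod-recip-suc (suc j) = begin
  prod (λ i → recip (suc i)) j * recip (suc j)   ≡⟨ cong (_* recip (suc j)) (prod-recip-suc j) ⟩
  recip (j !) * recip (suc j)                    ≡⟨ ℚP.*-comm (recip (j !)) (recip (suc j)) ⟩
  recip (suc j) * recip (j !)                    ≡⟨ recip-homo-* (suc j) (j !) ⟨
  recip (suc j !)                                ∎

ℤ→ℚ-foldr-* : ∀ (g : ℕ → ℤ) f j →
  ℤ→ℚ (foldr ℤ._*_ ℤ.1ℤ (List.map g (applyUpTo f j))) ≡ prod (ℤ→ℚ ∘ g ∘ f) j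
ℤ→ℚ-foldr-* g f zero    = refl
ℤ→ℚ-foldr-* g f (suc j) = begin
  ℤ→ℚ (g (f 0) ℤ.* foldr ℤ._*_ ℤ.1ℤ (List.map g (applyUpTo (f ∘ suc) j)))
    ≡⟨ ℤ→ℚ-homo-* (g (f 0)) _ ⟩
  ℤ→ℚ (g (f 0)) * ℤ→ℚ (foldr ℤ._*_ ℤ.1ℤ (List.map g (applyUpTo (f ∘ suc) j)))
    ≡⟨ cong (ℤ→ℚ (g (f 0)) *_) (ℤ→ℚ-foldr-* g (f ∘ suc) j) ⟩
  ℤ→ℚ (g (f 0)) * prod (ℤ→ℚ ∘ g ∘ f ∘ suc) j
    ≡⟨ prod-suc (ℤ→ℚ ∘ g ∘ f) j ⟨
  prod (ℤ→ℚ ∘ g ∘ f) (suc j)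
    ∎

infix 8 _choose_
_choose_ : ℚ → ℕ → ℚ
y choose j = prod (λ i → (y - ℕ→ℚ i) * recip (suc i)) j

choose-suc-mul : ∀ j y → (1ℚ + y) choose j * (1ℚ + y - ℕ→ℚ j) ≡ (1ℚ + y) * y choose j
choose-suc-mul zero    y = solve 1 (λ y → con 1ℚ :* (con 1ℚ :+ y :- con 0ℚ) := (con 1ℚ :+ y) :* con 1ℚ) refl y
choose-suc-mul (suc j) y = begin
  (1ℚ + y) choose j * ((1ℚ + y - J) * c) * (1ℚ + y - ℕ→ℚ (suc j))
    ≡⟨ cong (λ t → (1ℚ + y) choose j * ((1ℚ + y - J) * c) * (1ℚ + y - t)) (ℕ→ℚ-suc j) ⟩
  (1ℚ + y) choose j * ((1ℚ + y - J) * c) * (1ℚ + y - (1ℚ + J))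
    ≡⟨ solve 4 (λ f y J c → f :* ((con 1ℚ :+ y :- J) :* c) :* (con 1ℚ :+ y :- (con 1ℚ :+ J))
                         := f :* (con 1ℚ :+ y :- J) :* ((y :- J) :* c)) refl ((1ℚ + y) choose j) y J c ⟩
  (1ℚ + y) choose j * (1ℚ + y - J) * ((y - J) * c)
    ≡⟨ cong (_* ((y - J) * c)) (choose-suc-mul j y) ⟩
  (1ℚ + y) * y choose j * ((y - J) * c)
    ≡⟨ ℚP.*-assoc (1ℚ + y) (y choose j) ((y - J) * c) ⟩
  (1ℚ + y) * y choose suc j
    ∎
  where
  J = ℕ→ℚ j
  c = recip (suc j)

choose-pascal : ∀ j y → (1ℚ + y) choose suc j ≡ y choose j + y choose suc j
choose-pascal j y = begin
  (1ℚ + y) choose j * ((1ℚ + y - J) * c)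
    ≡⟨ ℚP.*-assoc ((1ℚ + y) choose j) (1ℚ + y - J) c ⟨
  (1ℚ + y) choose j * (1ℚ + y - J) * c
    ≡⟨ cong (_* c) (choose-suc-mul j y) ⟩
  (1ℚ + y) * y choose j * c
    ≡⟨ solve 4 (λ y g J c → (con 1ℚ :+ y) :* g :* c := g :* (c :* (con 1ℚ :+ J)) :+ g :* ((y :- J) :* c)) refl y (y choose j) J c ⟩
  y choose j * (c * (1ℚ + J)) + y choose suc j
    ≡⟨ cong (λ t → y choose j * t + y choose suc j) (trans (cong (c *_) (sym (ℕ→ℚ-suc j))) (recip-inverseˡ (suc j))) ⟩
  y choose j * 1ℚ + y choose suc j
    ≡⟨ cong (_+ y choose suc j) (ℚP.*-identityʳ (y choose j)) ⟩
  y choose j + y choose suc j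
    ∎
  where
  J = ℕ→ℚ j
  c = recip (suc j)

0-choose-suc : ∀ j → 0ℚ choose suc j ≡ 0ℚ
0-choose-suc zero    = refl
0-choose-suc (suc j) = trans (cong (_* factor) (0-choose-suc j)) (ℚP.*-zeroˡ factor)
  where factor = (0ℚ - ℕ→ℚ (suc j)) * recip (suc (suc j))

C≡choose : ∀ n j → ℕ→ℚ (n C j) ≡ ℕ→ℚ n choose j
C≡choose zero    zero    = refl
C≡choose zero    (suc j) = sym (0-choose-suc j)
C≡choose (suc n) zero    = refl
C≡choose (suc n) (suc j) = begin
  ℕ→ℚ (suc n C suc j)                         ≡⟨ cong ℕ→ℚ (nCk+nC[k+1]≡[n+1]C[k+1] n j) ⟨
  ℕ→ℚ (n C j ℕ.+ n C suc j)                   ≡⟨ ℕ→ℚ-homo-+ (n C j) (n C suc j) ⟩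
  ℕ→ℚ (n C j) + ℕ→ℚ (n C suc j)               ≡⟨ cong₂ _+_ (C≡choose n j) (C≡choose n (suc j)) ⟩
  ℕ→ℚ n choose j + ℕ→ℚ n choose suc j         ≡⟨ choose-pascal j (ℕ→ℚ n) ⟨
  (1ℚ + ℕ→ℚ n) choose suc j                   ≡⟨ cong (_choose suc j) (ℕ→ℚ-suc n) ⟨
  ℕ→ℚ (suc n) choose suc j                    ∎

C≡choose-shifted : ∀ n j s → ℕ→ℚ (n C j) ≡ (ℕ→ℚ (s ℕ.+ n) - ℕ→ℚ s) choose j
C≡choose-shifted n j s = trans (C≡choose n j) (cong (_choose j) (begin
  ℕ→ℚ n                          ≡⟨ solve 2 (λ S N → N := S :+ N :- S) refl (ℕ→ℚ s) (ℕ→ℚ n) ⟩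
  ℕ→ℚ s + ℕ→ℚ n - ℕ→ℚ s          ≡⟨ cong (_- ℕ→ℚ s) (ℕ→ℚ-homo-+ s n) ⟨
  ℕ→ℚ (s ℕ.+ n) - ℕ→ℚ s          ∎))

neg1^_ : ℕ → ℚ
neg1^ zero  = 1ℚ
neg1^ suc j = - neg1^ j

-2-choose : ∀ j → (0ℚ - ℕ→ℚ 2) choose j ≡ neg1^ j * ℕ→ℚ (suc j)
-2-choose zero    = refl
-2-choose (suc j) = begin
  (0ℚ - ℕ→ℚ 2) choose j * ((0ℚ - ℕ→ℚ 2 - J) * c)
    ≡⟨ cong (_* ((0ℚ - ℕ→ℚ 2 - J) * c)) (-2-choose j) ⟩
  neg1^ j * ℕ→ℚ (suc j) * ((0ℚ - ℕ→ℚ 2 - J) * c)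
    ≡⟨ solve 4 (λ s S J c → s :* S :* ((con 0ℚ :- con (ℕ→ℚ 2) :- J) :* c)
                         := :- s :* (con 1ℚ :+ (con 1ℚ :+ J)) :* (c :* S)) refl (neg1^ j) (ℕ→ℚ (suc j)) J c ⟩
  - neg1^ j * (1ℚ + (1ℚ + J)) * (c * ℕ→ℚ (suc j))
    ≡⟨ cong₂ (λ a b → - neg1^ j * a * b)
             (sym (trans (ℕ→ℚ-suc (suc j)) (cong (λ t → 1ℚ + t) (ℕ→ℚ-suc j)))) (recip-inverseˡ (suc j)) ⟩
  - neg1^ j * ℕ→ℚ (suc (suc j)) * 1ℚ
    ≡⟨ ℚP.*-identityʳ _ ⟩
  - neg1^ j * ℕ→ℚ (suc (suc j))
    ∎
  where
  J = ℕ→ℚ j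
  c = recip (suc j)

-- Polynomials are coefficient vectors, constant coefficient first.
eval : ∀ {n} → Vec ℚ n → ℚ → ℚ
eval []      y = 0ℚ
eval (a ∷ v) y = a + y * eval v y

leading : ∀ {n} → Vec ℚ (suc n) → ℚ
leading (a ∷ [])    = a
leading (a ∷ b ∷ v) = leading (b ∷ v)

scale : ∀ {n} → ℚ → Vec ℚ n → Vec ℚ n
scale s = map (s *_)

infixl 6 _⊕_
_⊕_ : ∀ {n} → Vec ℚ n → Vec ℚ n → Vec ℚ n
_⊕_ = zipWith _+_

mulLinear : ∀ {n} → ℚ → ℚ → Vec ℚ n → Vec ℚ (suc n)
mulLinear a b v = (0ℚ ∷ scale a v) ⊕ (scale b v ∷ʳ 0ℚ)

linearProduct : (ℕ → ℚ) → (ℕ → ℚ) → (j : ℕ) → Vec ℚ (suc j)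
linearProduct a b zero    = 1ℚ ∷ []
linearProduct a b (suc j) = mulLinear (a j) (b j) (linearProduct a b j)

eval-scale : ∀ {n} s (v : Vec ℚ n) y → eval (scale s v) y ≡ s * eval v y
eval-scale s []      y = sym (ℚP.*-zeroʳ s)
eval-scale s (a ∷ v) y = begin
  s * a + y * eval (scale s v) y    ≡⟨ cong (λ t → s * a + y * t) (eval-scale s v y) ⟩
  s * a + y * (s * eval v y)        ≡⟨ solve 4 (λ s a y e → s :* a :+ y :* (s :* e) := s :* (a :+ y :* e)) refl s a y (eval v y) ⟩
  s * (a + y * eval v y)            ∎

eval-⊕ : ∀ {n} (v w : Vec ℚ n) y → eval (v ⊕ w) y ≡ eval v y + eval w y
eval-⊕ []      []      y = refl
eval-⊕ (a ∷ v) (b ∷ w) y = begin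
  a + b + y * eval (v ⊕ w) y            ≡⟨ cong (λ t → a + b + y * t) (eval-⊕ v w y) ⟩
  a + b + y * (eval v y + eval w y)     ≡⟨ solve 5 (λ a b y e f → a :+ b :+ y :* (e :+ f) := a :+ y :* e :+ (b :+ y :* f))
                                                   refl a b y (eval v y) (eval w y) ⟩
  a + y * eval v y + (b + y * eval w y) ∎

eval-∷ʳ-0 : ∀ {n} (v : Vec ℚ n) y → eval (v ∷ʳ 0ℚ) y ≡ eval v y
eval-∷ʳ-0 []      y = trans (cong (0ℚ +_) (ℚP.*-zeroʳ y)) (ℚP.+-identityˡ 0ℚ)
eval-∷ʳ-0 (a ∷ v) y = cong (λ t → a + y * t) (eval-∷ʳ-0 v y)

eval-mulLinear : ∀ {n} a b (v : Vec ℚ n) y → eval (mulLinear a b v) y ≡ (a * y + b) * eval v y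
eval-mulLinear a b v y = begin
  eval ((0ℚ ∷ scale a v) ⊕ (scale b v ∷ʳ 0ℚ)) y
    ≡⟨ eval-⊕ (0ℚ ∷ scale a v) (scale b v ∷ʳ 0ℚ) y ⟩
  0ℚ + y * eval (scale a v) y + eval (scale b v ∷ʳ 0ℚ) y
    ≡⟨ cong₂ (λ s t → 0ℚ + y * s + t) (eval-scale a v y) (trans (eval-∷ʳ-0 (scale b v) y) (eval-scale b v y)) ⟩
  0ℚ + y * (a * eval v y) + b * eval v y
    ≡⟨ solve 4 (λ a b y e → con 0ℚ :+ y :* (a :* e) :+ b :* e := (a :* y :+ b) :* e) refl a b y (eval v y) ⟩
  (a * y + b) * eval v y
    ∎

eval-linearProduct : ∀ a b j y → eval (linearProduct a b j) y ≡ prod (λ i → a i * y + b i) j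
eval-linearProduct a b zero    y = trans (cong (1ℚ +_) (ℚP.*-zeroʳ y)) (ℚP.+-identityʳ 1ℚ)
eval-linearProduct a b (suc j) y = begin
  eval (mulLinear (a j) (b j) (linearProduct a b j)) y        ≡⟨ eval-mulLinear (a j) (b j) (linearProduct a b j) y ⟩
  (a j * y + b j) * eval (linearProduct a b j) y              ≡⟨ cong ((a j * y + b j) *_) (eval-linearProduct a b j y) ⟩
  (a j * y + b j) * prod (λ i → a i * y + b i) j              ≡⟨ ℚP.*-comm (a j * y + b j) _ ⟩
  prod (λ i → a i * y + b i) (suc j)                          ∎

eval-tail : ∀ {n} (v : Vec ℚ (suc n)) {y z} → eval v 0ℚ ≡ 0ℚ → z * y ≡ 1ℚ →
            eval (tail v) y ≡ z * eval v y
eval-tail (a ∷ v) {y} {z} v[0]≡0 z*y≡1 = begin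
  eval v y                  ≡⟨ ℚP.*-identityˡ (eval v y) ⟨
  1ℚ * eval v y             ≡⟨ cong (_* eval v y) z*y≡1 ⟨
  z * y * eval v y          ≡⟨ ℚP.*-assoc z y (eval v y) ⟩
  z * (y * eval v y)        ≡⟨ cong (z *_) (ℚP.+-identityˡ (y * eval v y)) ⟨
  z * (0ℚ + y * eval v y)   ≡⟨ cong (λ t → z * (t + y * eval v y)) a≡0 ⟨
  z * (a + y * eval v y)    ∎
  where
  a≡0 : a ≡ 0ℚ
  a≡0 = trans (sym (trans (cong (a +_) (ℚP.*-zeroˡ (eval v 0ℚ))) (ℚP.+-identityʳ a))) v[0]≡0

leading-scale : ∀ {n} s (v : Vec ℚ (suc n)) → leading (scale s v) ≡ s * leading v
leading-scale s (a ∷ [])    = refl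
leading-scale s (a ∷ b ∷ v) = leading-scale s (b ∷ v)

leading-⊕ : ∀ {n} (v w : Vec ℚ (suc n)) → leading (v ⊕ w) ≡ leading v + leading w
leading-⊕ (a ∷ [])    (c ∷ [])    = refl
leading-⊕ (a ∷ b ∷ v) (c ∷ d ∷ w) = leading-⊕ (b ∷ v) (d ∷ w)

leading-∷ʳ : ∀ {n} x (v : Vec ℚ n) → leading (v ∷ʳ x) ≡ x
leading-∷ʳ x []          = refl
leading-∷ʳ x (a ∷ [])    = refl
leading-∷ʳ x (a ∷ b ∷ v) = leading-∷ʳ x (b ∷ v)

leading-tail : ∀ {n} (v : Vec ℚ (suc (suc n))) → leading (tail v) ≡ leading v
leading-tail (a ∷ b ∷ v) = refl

leading-mulLinear : ∀ {n} a b (v : Vec ℚ (suc n)) → leading (mulLinear a b v) ≡ a * leading v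
leading-mulLinear a b v@(_ ∷ _) = begin
  leading ((0ℚ ∷ scale a v) ⊕ (scale b v ∷ʳ 0ℚ))      ≡⟨ leading-⊕ (0ℚ ∷ scale a v) (scale b v ∷ʳ 0ℚ) ⟩
  leading (scale a v) + leading (scale b v ∷ʳ 0ℚ)     ≡⟨ cong₂ _+_ (leading-scale a v) (leading-∷ʳ 0ℚ (scale b v)) ⟩
  a * leading v + 0ℚ                                  ≡⟨ ℚP.+-identityʳ (a * leading v) ⟩
  a * leading v                                       ∎

leading-linearProduct : ∀ a b j → leading (linearProduct a b j) ≡ prod a j
leading-linearProduct a b zero    = refl
leading-linearProduct a b (suc j) = begin
  leading (mulLinear (a j) (b j) (linearProduct a b j))   ≡⟨ leading-mulLinear (a j) (b j) (linearProduct a b j) ⟩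
  a j * leading (linearProduct a b j)                     ≡⟨ cong (a j *_) (leading-linearProduct a b j) ⟩
  a j * prod a j                                          ≡⟨ ℚP.*-comm (a j) (prod a j) ⟩
  prod a (suc j)                                          ∎

coeff : ∀ {n} → Vec ℚ n → ℕ → ℚ
coeff []      i       = 0ℚ
coeff (a ∷ v) zero    = a
coeff (a ∷ v) (suc i) = coeff v i

coeff-beyond : ∀ {n} (v : Vec ℚ n) i → n ≤ i → coeff v i ≡ 0ℚ
coeff-beyond []      i       _         = refl
coeff-beyond (a ∷ v) (suc i) (s≤s n≤i) = coeff-beyond v i n≤i

coeff-top : ∀ n (v : Vec ℚ (suc n)) → coeff v n ≡ leading v
coeff-top zero    (a ∷ [])    = refl
coeff-top (suc n) (a ∷ b ∷ v) = coeff-top n (b ∷ v)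

evalPoly-∷ : ∀ {n} d a (v : Vec ℚ n) x →
             evalPoly (coeff (a ∷ v)) (suc d) x ≡ a + ℕ→ℚ x * evalPoly (coeff v) d x
evalPoly-∷ zero    a v x =
  cong (λ t → a + t) (trans (cong (λ t → coeff v 0 * ℕ→ℚ t) (ℕP.*-identityʳ x)) (ℚP.*-comm (coeff v 0) (ℕ→ℚ x)))
evalPoly-∷ (suc d) a v x = begin
  evalPoly (coeff (a ∷ v)) (suc d) x + c * ℕ→ℚ (x ℕ.* x ℕ.^ suc d)
    ≡⟨ cong₂ (λ s t → s + c * t) (evalPoly-∷ d a v x) (ℕ→ℚ-homo-* x (x ℕ.^ suc d)) ⟩
  a + X * evalPoly (coeff v) d x + c * (X * ℕ→ℚ (x ℕ.^ suc d))
    ≡⟨ solve 5 (λ a X e c p → a :+ X :* e :+ c :* (X :* p) := a :+ X :* (e :+ c :* p))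
               refl a X (evalPoly (coeff v) d x) c (ℕ→ℚ (x ℕ.^ suc d)) ⟩
  a + X * evalPoly (coeff v) (suc d) x
    ∎
  where
  X = ℕ→ℚ x
  c = coeff v (suc d)

evalPoly-coeff : ∀ n (v : Vec ℚ (suc n)) x → evalPoly (coeff v) n x ≡ eval v (ℕ→ℚ x)
evalPoly-coeff zero    (a ∷ [])    x = sym (trans (cong (λ t → a + t) (ℚP.*-zeroʳ (ℕ→ℚ x))) (ℚP.+-identityʳ a))
evalPoly-coeff (suc n) (a ∷ b ∷ v) x = trans (evalPoly-∷ n a (b ∷ v) x) (cong (λ t → a + ℕ→ℚ x * t) (evalPoly-coeff n (b ∷ v) x))

binomialPoly : (j s : ℕ) → Vec ℚ (suc j)
binomialPoly j s = linearProduct (λ i → recip (suc i)) (λ i → - ℕ→ℚ (s ℕ.+ i) * recip (suc i)) j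

eval-binomialPoly : ∀ j s y → eval (binomialPoly j s) y ≡ (y - ℕ→ℚ s) choose j
eval-binomialPoly j s y = trans (eval-linearProduct _ _ j y) (prod-cong factor j)
  where
  factor : ∀ i → recip (suc i) * y + - ℕ→ℚ (s ℕ.+ i) * recip (suc i) ≡ (y - ℕ→ℚ s - ℕ→ℚ i) * recip (suc i)
  factor i = trans (cong (λ t → recip (suc i) * y + - t * recip (suc i)) (ℕ→ℚ-homo-+ s i))
    (solve 4 (λ c y S I → c :* y :+ :- (S :+ I) :* c := (y :- S :- I) :* c) refl (recip (suc i)) y (ℕ→ℚ s) (ℕ→ℚ i))

leading-binomialPoly : ∀ j s → leading (binomialPoly j s) ≡ recip (j !)
leading-binomialPoly j s = trans (leading-linearProduct _ _ j) (prod-recip-suc j)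

prodTermPoly : (m : ℕ) → Vec ℚ (suc m)
prodTermPoly = linearProduct (λ _ → ℕ→ℚ 2) (λ i → 1ℚ - ℕ→ℚ (2 ℕ.* (i ℕ.+ 2)))

eval-prodTermPoly : ∀ m n → eval (prodTermPoly m) (ℕ→ℚ n) ≡ ℤ→ℚ (prodTerm (suc (suc m)) n)
eval-prodTermPoly m n = begin
  eval (prodTermPoly m) (ℕ→ℚ n)                                  ≡⟨ eval-linearProduct _ _ m (ℕ→ℚ n) ⟩
  prod (λ i → ℕ→ℚ 2 * ℕ→ℚ n + (1ℚ - ℕ→ℚ (2 ℕ.* (i ℕ.+ 2)))) m     ≡⟨ prod-cong factor m ⟩
  prod (ℤ→ℚ ∘ oddFactor ∘ (ℕ._+ 2)) m                             ≡⟨ ℤ→ℚ-foldr-* oddFactor (ℕ._+ 2) m ⟨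
  ℤ→ℚ (prodTerm (suc (suc m)) n)                                  ∎
  where
  oddFactor : ℕ → ℤ
  oddFactor i = (ℤ.+ (2 ℕ.* n) ℤ.- ℤ.+ (2 ℕ.* i)) ℤ.+ ℤ.1ℤ
  factor : ∀ i → ℕ→ℚ 2 * ℕ→ℚ n + (1ℚ - ℕ→ℚ (2 ℕ.* (i ℕ.+ 2))) ≡ ℤ→ℚ (oddFactor (i ℕ.+ 2))
  factor i = sym (begin
    ℤ→ℚ ((ℤ.+ (2 ℕ.* n) ℤ.- ℤ.+ T) ℤ.+ ℤ.1ℤ)   ≡⟨ ℤ→ℚ-homo-+ (ℤ.+ (2 ℕ.* n) ℤ.- ℤ.+ T) ℤ.1ℤ ⟩
    ℤ→ℚ (ℤ.+ (2 ℕ.* n) ℤ.- ℤ.+ T) + 1ℚ         ≡⟨ cong (_+ 1ℚ) (ℤ→ℚ-homo-− (ℤ.+ (2 ℕ.* n)) (ℤ.+ T)) ⟩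
    ℕ→ℚ (2 ℕ.* n) + - ℕ→ℚ T + 1ℚ               ≡⟨ cong (λ s → s + - ℕ→ℚ T + 1ℚ) (ℕ→ℚ-homo-* 2 n) ⟩
    ℕ→ℚ 2 * ℕ→ℚ n + - ℕ→ℚ T + 1ℚ               ≡⟨ solve 3 (λ a x t → a :* x :+ :- t :+ con 1ℚ := a :* x :+ (con 1ℚ :- t))
                                                          refl (ℕ→ℚ 2) (ℕ→ℚ n) (ℕ→ℚ T) ⟩
    ℕ→ℚ 2 * ℕ→ℚ n + (1ℚ - ℕ→ℚ T)               ∎)
    where T = 2 ℕ.* (i ℕ.+ 2)

leading-prodTermPoly : ∀ m → leading (prodTermPoly m) ≡ ℕ→ℚ (2 ℕ.^ m)
leading-prodTermPoly m = trans (leading-linearProduct _ _ m) (prod-ℕ→ℚ-const 2 m)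

prodTermPoly-factor-at-0 : ∀ i → ℕ→ℚ 2 * 0ℚ + (1ℚ - ℕ→ℚ (2 ℕ.* (i ℕ.+ 2))) ≡ - ℕ→ℚ (3 ℕ.+ (i ℕ.+ i))
prodTermPoly-factor-at-0 i = begin
  ℕ→ℚ 2 * 0ℚ + (1ℚ - ℕ→ℚ (2 ℕ.* (i ℕ.+ 2)))   ≡⟨ cong (λ t → ℕ→ℚ 2 * 0ℚ + (1ℚ - ℕ→ℚ t)) (double-+2 i) ⟩
  ℕ→ℚ 2 * 0ℚ + (1ℚ - ℕ→ℚ (suc X))             ≡⟨ cong (λ t → ℕ→ℚ 2 * 0ℚ + (1ℚ - t)) (ℕ→ℚ-suc X) ⟩
  ℕ→ℚ 2 * 0ℚ + (1ℚ - (1ℚ + ℕ→ℚ X))            ≡⟨ solve 1 (λ x → con (ℕ→ℚ 2) :* con 0ℚ :+ (con 1ℚ :- (con 1ℚ :+ x)) := :- x)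
                                                         refl (ℕ→ℚ X) ⟩
  - ℕ→ℚ X                                     ∎
  where
  X = 3 ℕ.+ (i ℕ.+ i)
  double-+2 : ∀ i → 2 ℕ.* (i ℕ.+ 2) ≡ suc (3 ℕ.+ (i ℕ.+ i))
  double-+2 = solve-∀

double-factorial-identity : ∀ m →
  ℕ→ℚ (2 ℕ.^ suc m) * prod (λ i → - ℕ→ℚ (3 ℕ.+ (i ℕ.+ i))) m * ℕ→ℚ (suc m !)
    ≡ neg1^ m * ℕ→ℚ ((2 ℕ.+ (m ℕ.+ m)) !)
double-factorial-identity zero    = refl
double-factorial-identity (suc m) = begin
  ℕ→ℚ (2 ℕ.* 2 ℕ.^ suc m) * (q * - X) * ℕ→ℚ (suc (suc m) ℕ.* suc m !)
    ≡⟨ cong₂ (λ a b → a * (q * - X) * b) (ℕ→ℚ-homo-* 2 (2 ℕ.^ suc m)) (ℕ→ℚ-homo-* (suc (suc m)) (suc m !)) ⟩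
  ℕ→ℚ 2 * P * (q * - X) * (ℕ→ℚ (suc (suc m)) * F)
    ≡⟨ solve 6 (λ T P q X S F → T :* P :* (q :* :- X) :* (S :* F) := :- (P :* q :* F) :* (X :* (T :* S)))
               refl (ℕ→ℚ 2) P q X (ℕ→ℚ (suc (suc m))) F ⟩
  - (P * q * F) * (X * (ℕ→ℚ 2 * ℕ→ℚ (suc (suc m))))
    ≡⟨ cong₂ (λ a b → - a * (X * b)) (double-factorial-identity m)
             (trans (sym (ℕ→ℚ-homo-* 2 (suc (suc m)))) (cong ℕ→ℚ (double-2+ m))) ⟩
  - (neg1^ m * E) * (X * ℕ→ℚ (4 ℕ.+ (m ℕ.+ m)))
    ≡⟨ solve 4 (λ s E X Y → :- (s :* E) :* (X :* Y) := :- s :* (Y :* (X :* E))) refl (neg1^ m) E X (ℕ→ℚ (4 ℕ.+ (m ℕ.+ m))) ⟩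
  - neg1^ m * (ℕ→ℚ (4 ℕ.+ (m ℕ.+ m)) * (X * E))
    ≡⟨ cong (λ t → - neg1^ m * (ℕ→ℚ (4 ℕ.+ (m ℕ.+ m)) * t)) (ℕ→ℚ-homo-* (3 ℕ.+ (m ℕ.+ m)) ((2 ℕ.+ (m ℕ.+ m)) !)) ⟨
  - neg1^ m * (ℕ→ℚ (4 ℕ.+ (m ℕ.+ m)) * ℕ→ℚ ((3 ℕ.+ (m ℕ.+ m)) !))
    ≡⟨ cong (- neg1^ m *_) (ℕ→ℚ-homo-* (4 ℕ.+ (m ℕ.+ m)) ((3 ℕ.+ (m ℕ.+ m)) !)) ⟨
  - neg1^ m * ℕ→ℚ ((4 ℕ.+ (m ℕ.+ m)) !)
    ≡⟨ cong (λ t → - neg1^ m * ℕ→ℚ ((2 ℕ.+ t) !)) (double-suc m) ⟩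
  - neg1^ m * ℕ→ℚ ((2 ℕ.+ (suc m ℕ.+ suc m)) !)
    ∎
  where
  q = prod (λ i → - ℕ→ℚ (3 ℕ.+ (i ℕ.+ i))) m
  X = ℕ→ℚ (3 ℕ.+ (m ℕ.+ m))
  P = ℕ→ℚ (2 ℕ.^ suc m)
  F = ℕ→ℚ (suc m !)
  E = ℕ→ℚ ((2 ℕ.+ (m ℕ.+ m)) !)
  double-2+ : ∀ m → 2 ℕ.* (2 ℕ.+ m) ≡ 4 ℕ.+ (m ℕ.+ m)
  double-2+ = solve-∀
  double-suc : ∀ m → 2 ℕ.+ (m ℕ.+ m) ≡ suc m ℕ.+ suc m
  double-suc = solve-∀

prodTermPoly-at-0 : ∀ m →
  ℕ→ℚ (2 ℕ.^ suc m) * eval (prodTermPoly m) 0ℚ * ℕ→ℚ (suc m !) ≡ neg1^ m * ℕ→ℚ ((2 ℕ.+ (m ℕ.+ m)) !)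
prodTermPoly-at-0 m = trans
  (cong (λ t → ℕ→ℚ (2 ℕ.^ suc m) * t * ℕ→ℚ (suc m !))
        (trans (eval-linearProduct _ _ m 0ℚ) (prod-cong prodTermPoly-factor-at-0 m)))
  (double-factorial-identity m)

module _ (m : ℕ) where

  private
    k G : ℕ
    k = suc (suc m)
    G = (2 ℕ.* k ∸ 1) !

    P A B u w h : ℚ
    P = ℕ→ℚ (2 ℕ.^ suc m)
    A = ℕ→ℚ (2 ℕ.* k)
    B = ℕ→ℚ (2 ℕ.* k ∸ 1)
    u = recip (k !)
    w = recip G
    h = recip (2 ℕ.* suc m !)

  -- y ↦ (y-2 choose k-1)/k! - 2^(k-1) (2k y - (2k-1)) ∏_{i=2}^{k-1} (2y-2i+1) / (2k-1)!,
  -- the part of a11 carrying the factor 1/n; it vanishes at y = 0.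
  divisiblePart : Vec ℚ (suc (suc m))
  divisiblePart = scale u (binomialPoly (suc m) 2) ⊕ scale (- (P * w)) (mulLinear A (- B) (prodTermPoly m))

  eval-divisiblePart : ∀ y → eval divisiblePart y ≡ u * (y - ℕ→ℚ 2) choose suc m + - (P * w) * ((A * y + - B) * eval (prodTermPoly m) y)
  eval-divisiblePart y = begin
    eval (scale u V₁ ⊕ scale (- (P * w)) V₂) y
      ≡⟨ eval-⊕ (scale u V₁) (scale (- (P * w)) V₂) y ⟩
    eval (scale u V₁) y + eval (scale (- (P * w)) V₂) y
      ≡⟨ cong₂ _+_ (eval-scale u V₁ y) (eval-scale (- (P * w)) V₂ y) ⟩
    u * eval V₁ y + - (P * w) * eval V₂ y
      ≡⟨ cong₂ (λ s t → u * s + - (P * w) * t) (eval-binomialPoly (suc m) 2 y) (eval-mulLinear A (- B) (prodTermPoly m) y) ⟩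
    u * (y - ℕ→ℚ 2) choose suc m + - (P * w) * ((A * y + - B) * eval (prodTermPoly m) y)
      ∎
    where
    V₁ = binomialPoly (suc m) 2
    V₂ = mulLinear A (- B) (prodTermPoly m)

  divisiblePart-at-0 : eval divisiblePart 0ℚ ≡ 0ℚ
  divisiblePart-at-0 = begin
    eval divisiblePart 0ℚ
      ≡⟨ eval-divisiblePart 0ℚ ⟩
    u * (0ℚ - ℕ→ℚ 2) choose suc m + - (P * w) * ((A * 0ℚ + - B) * Q₀)
      ≡⟨ cong (λ t → u * t + - (P * w) * ((A * 0ℚ + - B) * Q₀)) (-2-choose (suc m)) ⟩
    u * (- neg1^ m * ℕ→ℚ k) + - (P * w) * ((A * 0ℚ + - B) * Q₀)
      ≡⟨ solve 8 (λ u s K P w A B Q → u :* (:- s :* K) :+ :- (P :* w) :* ((A :* con 0ℚ :+ :- B) :* Q)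
                                   := w :* B :* (P :* Q) :- s :* (u :* K)) refl u (neg1^ m) (ℕ→ℚ k) P w A B Q₀ ⟩
    w * B * (P * Q₀) - neg1^ m * (u * ℕ→ℚ k)
      ≡⟨ cong₂ (λ a b → a * (P * Q₀) - neg1^ m * b) w*B≡ (recip-*-cancelˡ k (suc m !)) ⟩
    recip E * (P * Q₀) - neg1^ m * recip (suc m !)
      ≡⟨ cong (_- neg1^ m * recip (suc m !)) recip[E]*P*Q₀ ⟩
    neg1^ m * recip (suc m !) - neg1^ m * recip (suc m !)
      ≡⟨ ℚP.+-inverseʳ (neg1^ m * recip (suc m !)) ⟩
    0ℚ
      ∎
    where
    Q₀ = eval (prodTermPoly m) 0ℚ
    E = (2 ℕ.+ (m ℕ.+ m)) !
    w*B≡ : w * B ≡ recip E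
    w*B≡ = trans (recip-*-cancelˡ (2 ℕ.* k ∸ 1) ((2 ℕ.* k ∸ 2) !)) (cong (λ t → recip (t !)) (2k∸2≡ m))
      where
      2k∸2≡ : ∀ m → m ℕ.+ (2 ℕ.+ (m ℕ.+ 0)) ≡ 2 ℕ.+ (m ℕ.+ m)
      2k∸2≡ = solve-∀
    recip[E]*P*Q₀ : recip E * (P * Q₀) ≡ neg1^ m * recip (suc m !)
    recip[E]*P*Q₀ = begin
      recip E * (P * Q₀)
        ≡⟨ ℚP.*-identityʳ _ ⟨
      recip E * (P * Q₀) * 1ℚ
        ≡⟨ cong (recip E * (P * Q₀) *_) (recip-inverseˡ (suc m !) {{suc m !≢0}}) ⟨
      recip E * (P * Q₀) * (recip F * ℕ→ℚ F)
        ≡⟨ solve 5 (λ e p q r f → e :* (p :* q) :* (r :* f) := e :* (p :* q :* f) :* r) refl (recip E) P Q₀ (recip F) (ℕ→ℚ F) ⟩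
      recip E * (P * Q₀ * ℕ→ℚ F) * recip F
        ≡⟨ cong (λ t → recip E * t * recip F) (prodTermPoly-at-0 m) ⟩
      recip E * (neg1^ m * ℕ→ℚ E) * recip F
        ≡⟨ solve 4 (λ e s E r → e :* (s :* E) :* r := s :* r :* (e :* E)) refl (recip E) (neg1^ m) (ℕ→ℚ E) (recip F) ⟩
      neg1^ m * recip F * (recip E * ℕ→ℚ E)
        ≡⟨ cong (neg1^ m * recip F *_) (recip-inverseˡ E {{2 ℕ.+ (m ℕ.+ m) !≢0}}) ⟩
      neg1^ m * recip F * 1ℚ
        ≡⟨ ℚP.*-identityʳ _ ⟩
      neg1^ m * recip F
        ∎
      where F = suc m !

  a11Poly : Vec ℚ (suc m)
  a11Poly = scale u (binomialPoly m 2) ⊕ tail divisiblePart ⊕ scale h (binomialPoly m 1)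

  eval-a11Poly-by-parts : ∀ {y z} → z * y ≡ 1ℚ →
    eval a11Poly y ≡ u * (y - ℕ→ℚ 2) choose m + z * eval divisiblePart y + h * (y - ℕ→ℚ 1) choose m
  eval-a11Poly-by-parts {y} {z} z*y≡1 = begin
    eval (scale u V₁ ⊕ tail divisiblePart ⊕ scale h V₂) y
      ≡⟨ eval-⊕ (scale u V₁ ⊕ tail divisiblePart) (scale h V₂) y ⟩
    eval (scale u V₁ ⊕ tail divisiblePart) y + eval (scale h V₂) y
      ≡⟨ cong (_+ eval (scale h V₂) y) (eval-⊕ (scale u V₁) (tail divisiblePart) y) ⟩
    eval (scale u V₁) y + eval (tail divisiblePart) y + eval (scale h V₂) y
      ≡⟨ cong₂ _+_ (cong₂ _+_ (eval-scale u V₁ y) (eval-tail divisiblePart {y} {z} divisiblePart-at-0 z*y≡1))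
                   (eval-scale h V₂ y) ⟩
    u * eval V₁ y + z * eval divisiblePart y + h * eval V₂ y
      ≡⟨ cong₂ (λ s t → u * s + z * eval divisiblePart y + h * t) (eval-binomialPoly m 2 y) (eval-binomialPoly m 1 y) ⟩
    u * (y - ℕ→ℚ 2) choose m + z * eval divisiblePart y + h * (y - ℕ→ℚ 1) choose m
      ∎
    where
    V₁ = binomialPoly m 2
    V₂ = binomialPoly m 1

  module _ (n : ℕ) where
    private
      N = suc (suc n)
      x = ℕ→ℚ N
      v = recip N
      Q = eval (prodTermPoly m) x
      Z = ℤ.+ (2 ℕ.^ (k ∸ 1)) ℤ.* (ℤ.+ (2 ℕ.* k ℕ.* N) ℤ.- ℤ.+ (2 ℕ.* k ∸ 1)) ℤ.* prodTerm k N

    a11-via-recip : a11 k N ≡ ℕ→ℚ (n C m) * u + ℕ→ℚ (n C suc m) * (v * u) + ℕ→ℚ (suc n C m) * h - ℤ→ℚ Z * (v * w)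
    a11-via-recip = cong₂ _-_
      (cong₂ _+_ (cong₂ _+_ (divℕ≡*recip (ℕ→ℚ (n C m)) (k !))
                            (trans (divℕ≡*recip (ℕ→ℚ (n C suc m)) (N ℕ.* k !)) (cong (ℕ→ℚ (n C suc m) *_) (recip-homo-* N (k !)))))
                 (divℕ≡*recip (ℕ→ℚ (suc n C m)) (2 ℕ.* suc m !)))
      (trans (divℕ≡*recip (ℤ→ℚ Z) (N ℕ.* (2 ℕ.* k ∸ 1) !)) (cong (ℤ→ℚ Z *_) (recip-homo-* N ((2 ℕ.* k ∸ 1) !))))

    ℤ→ℚ-lastNumerator : ℤ→ℚ Z ≡ P * (A * x + - B) * Q
    ℤ→ℚ-lastNumerator = begin
      ℤ→ℚ Z
        ≡⟨ ℤ→ℚ-homo-* (ℤ.+ (2 ℕ.^ suc m) ℤ.* (ℤ.+ (2 ℕ.* k ℕ.* N) ℤ.- ℤ.+ (2 ℕ.* k ∸ 1))) (prodTerm k N) ⟩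
      ℤ→ℚ (ℤ.+ (2 ℕ.^ suc m) ℤ.* (ℤ.+ (2 ℕ.* k ℕ.* N) ℤ.- ℤ.+ (2 ℕ.* k ∸ 1))) * ℤ→ℚ (prodTerm k N)
        ≡⟨ cong₂ _*_ (ℤ→ℚ-homo-* (ℤ.+ (2 ℕ.^ suc m)) _) (sym (eval-prodTermPoly m N)) ⟩
      P * ℤ→ℚ (ℤ.+ (2 ℕ.* k ℕ.* N) ℤ.- ℤ.+ (2 ℕ.* k ∸ 1)) * Q
        ≡⟨ cong (λ t → P * t * Q) (ℤ→ℚ-homo-− (ℤ.+ (2 ℕ.* k ℕ.* N)) (ℤ.+ (2 ℕ.* k ∸ 1))) ⟩
      P * (ℕ→ℚ (2 ℕ.* k ℕ.* N) + - B) * Q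
        ≡⟨ cong (λ t → P * (t + - B) * Q) (ℕ→ℚ-homo-* (2 ℕ.* k) N) ⟩
      P * (A * x + - B) * Q
        ∎

    eval-a11Poly : eval a11Poly x ≡ a11 k N
    eval-a11Poly = begin
      eval a11Poly x
        ≡⟨ eval-a11Poly-by-parts {x} {v} (recip-inverseˡ N) ⟩
      u * b₀ + v * eval divisiblePart x + h * b₂
        ≡⟨ cong (λ t → u * b₀ + v * t + h * b₂) (eval-divisiblePart x) ⟩
      u * b₀ + v * (u * b₁ + - (P * w) * ((A * x + - B) * Q)) + h * b₂
        ≡⟨ solve 12 (λ u v h w P A B x Q b₀ b₁ b₂ →
                       u :* b₀ :+ v :* (u :* b₁ :+ :- (P :* w) :* ((A :* x :+ :- B) :* Q)) :+ h :* b₂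
                    := b₀ :* u :+ b₁ :* (v :* u) :+ b₂ :* h :- P :* (A :* x :+ :- B) :* Q :* (v :* w))
                 refl u v h w P A B x Q b₀ b₁ b₂ ⟩
      b₀ * u + b₁ * (v * u) + b₂ * h - P * (A * x + - B) * Q * (v * w)
        ≡⟨ cong₂ _-_ (cong₂ _+_ (cong₂ _+_ (cong (_* u) (C≡choose-shifted n m 2))
                                          (cong (_* (v * u)) (C≡choose-shifted n (suc m) 2)))
                                (cong (_* h) (C≡choose-shifted (suc n) m 1)))
                     (cong (_* (v * w)) ℤ→ℚ-lastNumerator) ⟨
      ℕ→ℚ (n C m) * u + ℕ→ℚ (n C suc m) * (v * u) + ℕ→ℚ (suc n C m) * h - ℤ→ℚ Z * (v * w)
        ≡⟨ a11-via-recip ⟨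
      a11 k N
        ∎
      where
      b₀ = (x - ℕ→ℚ 2) choose m
      b₁ = (x - ℕ→ℚ 2) choose suc m
      b₂ = (x - ℕ→ℚ 1) choose m

  leading-a11Poly : leading a11Poly ≡ u * recip (m !) + (u * recip (suc m !) + - (P * w) * (A * ℕ→ℚ (2 ℕ.^ m))) + h * recip (m !)
  leading-a11Poly = begin
    leading (scale u V₁ ⊕ tail divisiblePart ⊕ scale h V₂)
      ≡⟨ leading-⊕ (scale u V₁ ⊕ tail divisiblePart) (scale h V₂) ⟩
    leading (scale u V₁ ⊕ tail divisiblePart) + leading (scale h V₂)
      ≡⟨ cong (_+ leading (scale h V₂)) (leading-⊕ (scale u V₁) (tail divisiblePart)) ⟩
    leading (scale u V₁) + leading (tail divisiblePart) + leading (scale h V₂)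
      ≡⟨ cong₂ _+_ (cong₂ _+_ (leading-scale u V₁) (leading-tail divisiblePart)) (leading-scale h V₂) ⟩
    u * leading V₁ + leading divisiblePart + h * leading V₂
      ≡⟨ cong (λ t → u * leading V₁ + t + h * leading V₂) (leading-⊕ (scale u V₃) (scale (- (P * w)) V₄)) ⟩
    u * leading V₁ + (leading (scale u V₃) + leading (scale (- (P * w)) V₄)) + h * leading V₂
      ≡⟨ cong (λ t → u * leading V₁ + t + h * leading V₂) (cong₂ _+_ (leading-scale u V₃) (leading-scale (- (P * w)) V₄)) ⟩
    u * leading V₁ + (u * leading V₃ + - (P * w) * leading V₄) + h * leading V₂
      ≡⟨ cong₂ (λ s t → u * s + (u * leading V₃ + - (P * w) * t) + h * leading V₂)
               (leading-binomialPoly m 2) (trans (leading-mulLinear A (- B) (prodTermPoly m)) (cong (A *_) (leading-prodTermPoly m))) ⟩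
    u * recip (m !) + (u * leading V₃ + - (P * w) * (A * ℕ→ℚ (2 ℕ.^ m))) + h * leading V₂
      ≡⟨ cong₂ (λ s t → u * recip (m !) + (u * s + - (P * w) * (A * ℕ→ℚ (2 ℕ.^ m))) + h * t)
               (leading-binomialPoly (suc m) 2) (leading-binomialPoly m 1) ⟩
    u * recip (m !) + (u * recip (suc m !) + - (P * w) * (A * ℕ→ℚ (2 ℕ.^ m))) + h * recip (m !)
      ∎
    where
    V₁ = binomialPoly m 2
    V₂ = binomialPoly m 1
    V₃ = binomialPoly (suc m) 2
    V₄ = mulLinear A (- B) (prodTermPoly m)

  denominator numerator⁺ numerator⁻ : ℕ
  denominator = 2 ℕ.* k ℕ.* suc m ℕ.* suc m ℕ.* (m ! ℕ.* m !) ℕ.* G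
  numerator⁺  = k ℕ.* suc k ℕ.* G
  numerator⁻  = 2 ℕ.^ suc m ℕ.* (2 ℕ.* k ℕ.* 2 ℕ.^ m) ℕ.* (2 ℕ.* k ℕ.* suc m ℕ.* suc m ℕ.* (m ! ℕ.* m !))

  leading-a11Poly-cleared : leading a11Poly * ℕ→ℚ denominator ≡ ℕ→ℚ numerator⁺ - ℕ→ℚ numerator⁻
  leading-a11Poly-cleared = begin
    leading a11Poly * D
      ≡⟨ cong (_* D) leading-a11Poly ⟩
    (u * r₀ + (u * r₁ + - (P * w) * (A * p)) + h * r₀) * D
      ≡⟨ solve 9 (λ u r₀ r₁ P w A p h D → (u :* r₀ :+ (u :* r₁ :+ :- (P :* w) :* (A :* p)) :+ h :* r₀) :* D
                                         := u :* r₀ :* D :+ u :* r₁ :* D :+ h :* r₀ :* D :- P :* (A :* p) :* (w :* D))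
               refl u r₀ r₁ P w A p h D ⟩
    u * r₀ * D + u * r₁ * D + h * r₀ * D - P * (A * p) * (w * D)
      ≡⟨ cong₂ _-_ (cong₂ _+_ (cong₂ _+_ (cancel (k !) (m !) (2 ℕ.* suc m ℕ.* G) {{k !* m !≢0}} (e₁ m (m !) G))
                                         (cancel (k !) (suc m !) (2 ℕ.* G) {{k !* suc m !≢0}} (e₂ m (m !) G)))
                              (cancel (2 ℕ.* suc m !) (m !) (k ℕ.* suc m ℕ.* G)
                                      {{ℕP.m*n≢0 _ _ {{ℕP.m*n≢0 2 _ {{_}} {{suc m !≢0}}}} {{m !≢0}}}} (e₃ m (m !) G)))
                   (cong (P * (A * p) *_) (recip-cancel-ℕ→ℚ G c′ {{(2 ℕ.* k ∸ 1) !≢0}} (e₄ m (m !) G))) ⟩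
    ℕ→ℚ (2 ℕ.* suc m ℕ.* G) + ℕ→ℚ (2 ℕ.* G) + ℕ→ℚ (k ℕ.* suc m ℕ.* G) - P * (A * p) * ℕ→ℚ c′
      ≡⟨ cong₂ _-_ (trans (cong (_+ ℕ→ℚ (k ℕ.* suc m ℕ.* G)) (sym (ℕ→ℚ-homo-+ (2 ℕ.* suc m ℕ.* G) (2 ℕ.* G))))
                          (trans (sym (ℕ→ℚ-homo-+ (2 ℕ.* suc m ℕ.* G ℕ.+ 2 ℕ.* G) _)) (cong ℕ→ℚ (sum m G))))
                   (sym (trans (ℕ→ℚ-homo-* (2 ℕ.^ suc m ℕ.* (2 ℕ.* k ℕ.* 2 ℕ.^ m)) c′)
                               (cong (_* ℕ→ℚ c′) (trans (ℕ→ℚ-homo-* (2 ℕ.^ suc m) _)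
                                                        (cong (P *_) (ℕ→ℚ-homo-* (2 ℕ.* k) (2 ℕ.^ m))))))) ⟩
    ℕ→ℚ numerator⁺ - ℕ→ℚ numerator⁻
      ∎
    where
    D = ℕ→ℚ denominator
    r₀ = recip (m !)
    r₁ = recip (suc m !)
    p = ℕ→ℚ (2 ℕ.^ m)
    c′ = 2 ℕ.* k ℕ.* suc m ℕ.* suc m ℕ.* (m ! ℕ.* m !)
    cancel : ∀ a b c .{{_ : NonZero (a ℕ.* b)}} → a ℕ.* b ℕ.* c ≡ denominator → recip a * recip b * D ≡ ℕ→ℚ c
    cancel a b c eq = trans (cong (_* D) (sym (recip-homo-* a b))) (recip-cancel-ℕ→ℚ (a ℕ.* b) c eq)
    e₁ : ∀ m F G → suc (suc m) ℕ.* (suc m ℕ.* F) ℕ.* F ℕ.* (2 ℕ.* suc m ℕ.* G)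
                   ≡ 2 ℕ.* suc (suc m) ℕ.* suc m ℕ.* suc m ℕ.* (F ℕ.* F) ℕ.* G
    e₁ = solve-∀
    e₂ : ∀ m F G → suc (suc m) ℕ.* (suc m ℕ.* F) ℕ.* (suc m ℕ.* F) ℕ.* (2 ℕ.* G)
                   ≡ 2 ℕ.* suc (suc m) ℕ.* suc m ℕ.* suc m ℕ.* (F ℕ.* F) ℕ.* G
    e₂ = solve-∀
    e₃ : ∀ m F G → 2 ℕ.* (suc m ℕ.* F) ℕ.* F ℕ.* (suc (suc m) ℕ.* suc m ℕ.* G)
                   ≡ 2 ℕ.* suc (suc m) ℕ.* suc m ℕ.* suc m ℕ.* (F ℕ.* F) ℕ.* G
    e₃ = solve-∀
    e₄ : ∀ m F G → G ℕ.* (2 ℕ.* suc (suc m) ℕ.* suc m ℕ.* suc m ℕ.* (F ℕ.* F))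
                   ≡ 2 ℕ.* suc (suc m) ℕ.* suc m ℕ.* suc m ℕ.* (F ℕ.* F) ℕ.* G
    e₄ = solve-∀
    sum : ∀ m G → 2 ℕ.* suc m ℕ.* G ℕ.+ 2 ℕ.* G ℕ.+ suc (suc m) ℕ.* suc m ℕ.* G ≡ suc (suc m) ℕ.* suc (suc (suc m)) ℕ.* G
    sum = solve-∀

  numerator⁻≤numerator⁺ : numerator⁻ ≤ numerator⁺
  numerator⁻≤numerator⁺ = ℕP.*-cancelˡ-≤ 2 (subst₂ _≤_ (double⁻ m (2 ℕ.^ m) (m !)) double⁺ (central-binomial-bound k))
    where
    double⁻ : ∀ m p F →
      2 ℕ.* (2 ℕ.* p) ℕ.* (2 ℕ.* (2 ℕ.* p)) ℕ.* (suc (suc m) ℕ.* (suc m ℕ.* F) ℕ.* (suc (suc m) ℕ.* (suc m ℕ.* F)))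
        ≡ 2 ℕ.* (2 ℕ.* p ℕ.* (2 ℕ.* suc (suc m) ℕ.* p) ℕ.* (2 ℕ.* suc (suc m) ℕ.* suc m ℕ.* suc m ℕ.* (F ℕ.* F)))
    double⁻ = solve-∀
    double⁺ : suc k ℕ.* (k ℕ.+ k) ! ≡ 2 ℕ.* numerator⁺
    double⁺ = begin
      suc k ℕ.* ((k ℕ.+ k) ℕ.* (suc (m ℕ.+ suc (suc m))) !)
        ≡⟨ cong (λ t → suc k ℕ.* ((k ℕ.+ k) ℕ.* (suc (m ℕ.+ suc (suc t))) !)) (ℕP.+-identityʳ m) ⟨
      suc k ℕ.* ((k ℕ.+ k) ℕ.* G)
        ≡⟨ regroup m G ⟩
      2 ℕ.* numerator⁺
        ∎
      where
      regroup : ∀ m G → suc (suc (suc m)) ℕ.* ((suc (suc m) ℕ.+ suc (suc m)) ℕ.* G)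
                      ≡ 2 ℕ.* (suc (suc m) ℕ.* suc (suc (suc m)) ℕ.* G)
      regroup = solve-∀

  leading-a11Poly-nonNeg : 0ℚ ≤ℚ leading a11Poly
  leading-a11Poly-nonNeg = *ℕ≡ℕ⇒nonNeg (leading a11Poly) denominator (numerator⁺ ∸ numerator⁻)
    {{ℕP.m*n≢0 (2 ℕ.* k ℕ.* suc m ℕ.* suc m ℕ.* (m ! ℕ.* m !)) G
               {{ℕP.m*n≢0 (2 ℕ.* k ℕ.* suc m ℕ.* suc m) (m ! ℕ.* m !) {{_}} {{m !* m !≢0}}}} {{(2 ℕ.* k ∸ 1) !≢0}}}}
    (trans leading-a11Poly-cleared (sym (ℕ→ℚ-homo-∸ numerator⁺ numerator⁻ numerator⁻≤numerator⁺)))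

lemma2p19 : (k : ℕ) → 2 ≤ k →
    Σ (ℕ → ℚ) λ c →
    ((i : ℕ) → k ∸ 2 < i → c i ≡ 0ℚ)
    × ∃ (λ N → (n : ℕ) → N ≤ n → evalPoly c (k ∸ 2) n ≡ a11 k n)
    × (0ℚ ≤ℚ c (k ∸ 2))
lemma2p19 0             ()
lemma2p19 1             (s≤s ())
lemma2p19 (suc (suc m)) _ =
    coeff (a11Poly m)
  , (λ i m<i → coeff-beyond (a11Poly m) i m<i)
  , (2 , agrees)
  , subst (0ℚ ≤ℚ_) (sym (coeff-top m (a11Poly m))) (leading-a11Poly-nonNeg m)
  where
  agrees : ∀ n → 2 ≤ n → evalPoly (coeff (a11Poly m)) m n ≡ a11 (suc (suc m)) n
  agrees 0             ()
  agrees 1             (s≤s ())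
  agrees (suc (suc n)) _ = trans (evalPoly-coeff m (a11Poly m) (suc (suc n))) (eval-a11Poly m n)
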